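{- Let $k\geq 4$ with $k\equiv 0\pmod 4$, and let $\Sigma_k=\{1,2,\dots,k\}$. Let $w\in\Sigma_k^*$ be a finite word with prefix $u_0=12\cdots(k-1)$ whose encoding $t(w)$ lies in $\{31,2\}^*$. Suppose $u=u_1u_2\cdots u_{k-1}$ is a factor of $w$, where $u_1,\dots,u_{k-1}\in\Sigma_k$ are pairwise distinct letters. Then $u^R=u_{k-1}\cdots u_2u_1$ is not a factor of $w$.
   Context: Ranking permutation: let $p\in\Sigma_k^*$ be a word containing at least $k-1$ distinct letters whose length-$(k-2)$ suffix consists of $k-2$ distinct letters. Its ranking is the permutation $r$ of $\Sigma_k$ (written as the list $r[1],r[2],\dots,r[k]$) with $r[3]r[4]\cdots r[k]$ equal to the length-$(k-2)$ suffix of $p$, and where, of the two letters of $\Sigma_k\setminus\{r[3],\dots,r[k]\}$, $r[2]$ is the one whose last occurrence in $p$ is later (a letter not occurring in $p$ counts as occurring earlier than any occurring letter) and $r[1]$ is the other one. Encoding: a word $w=u_0v_1v_2\cdots v_n$ (letters $v_i\in\Sigma_k$) with prefix $u_0=12\cdots(k-1)$ has encoding $t(w)=t_1\cdots t_n$ over $\{1,2,3\}$ if for each $i$, $v_i=r_{i-1}[t_i]$, where $r_{i-1}$ is the ranking of $p_{i-1}=u_0v_1\cdots v_{i-1}$ (so every letter $v_i$ must lie in $\{r_{i-1}[1],r_{i-1}[2],r_{i-1}[3]\}$). Conversely any word $t$ over $\{1,2,3\}$ determines a unique word with prefix $u_0$ and encoding $t$ by this rule (applied letter by letter, also for infinite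 $t$). -}

module Defs where

open import Data.Nat using (ℕ; suc; _<_; _<?_; _∸_; _≤_)
open import Data.Fin using (Fin; toℕ; zero; suc)
open import Data.List using (List; []; _∷_; _++_; [_]; length; drop; filter; map; allFin)
open import Data.List.Membership.Propositional using (_∈_; _∉_)
open import Data.Product using (Σ; ∃; _×_)
open import Data.Unit using (⊤)
open import Data.Empty using (⊥)
open import Function.Definitions using (Injective)
open import Relation.Binary.PropositionalEquality using (_≡_)

-- The alphabet Σ_k = {1,…,k} is represented by Fin k, letter i+1 ↦ (i : Fin k).
-- Words over Σ_k are lists.

u₀ : (k : ℕ) → List (Fin k)
u₀ k = filter (λ x → suc (toℕ x) <? k) (allFin k)

Factor : {A : Set} → List A → List A → Set
Factor {A} u w = Σ (List A) λ xs → Σ (List A) λ ys → w ≡ xs ++ (u ++ ys)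

-- "the last occurrence of a in p is later than that of b"
-- (a letter not occurring counts as occurring earlier than any occurring letter):
-- some occurrence of a in p is followed by no occurrence of b.
LastOccLater : {k : ℕ} → List (Fin k) → Fin k → Fin k → Set
LastOccLater {k} p a b =
  Σ (List (Fin k)) λ xs → Σ (List (Fin k)) λ ys → (p ≡ xs ++ (a ∷ ys)) × (b ∉ ys)

HasDistinct : {k : ℕ} → List (Fin k) → ℕ → Set
HasDistinct {k} p n = Σ (Fin n → Fin k) λ f → Injective _≡_ _≡_ f × (∀ j → f j ∈ p)

-- r : Fin k → Fin k is the ranking of p; r zero = r[1], r (suc zero) = r[2], …
IsRanking : {k : ℕ} → List (Fin k) → (Fin k → Fin k) → Set
IsRanking {k} p r =
    HasDistinct p (k ∸ 1)
  × Injective _≡_ _≡_ r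
  -- r[3] ⋯ r[k] is the length-(k-2) suffix of p (so that suffix has k-2 distinct letters)
  × (k ∸ 2 ≤ length p)
  × (drop (length p ∸ (k ∸ 2)) p ≡ map r (drop 2 (allFin k)))
  -- r[2] is the one of the two remaining letters r[1], r[2] whose last occurrence is later
  × (∀ (i₁ i₂ : Fin k) → toℕ i₁ ≡ 0 → toℕ i₂ ≡ 1 → LastOccLater p (r i₂) (r i₁))

-- Enc p v t : starting from the word p, the continuation v is produced by
-- the encoding letters t ∈ {1,2,3}* (Fin 3, letter c+1 ↦ c): each next letter
-- is r[t_i] where r is the ranking of the current prefix.
Enc : {k : ℕ} → List (Fin k) → List (Fin k) → List (Fin 3) → Set
Enc p [] [] = ⊤
Enc {k} p (x ∷ v) (c ∷ t) =
  (Σ (Fin k → Fin k) λ r → IsRanking p r × Σ (Fin k) λ j → (toℕ j ≡ toℕ c) × (x ≡ r j))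
  × Enc (p ++ [ x ]) v t
Enc p [] (_ ∷ _) = ⊥
Enc p (_ ∷ _) [] = ⊥

HasEncoding : (k : ℕ) → List (Fin k) → List (Fin 3) → Set
HasEncoding k w t = Σ (List (Fin k)) λ v → (w ≡ u₀ k ++ v) × Enc (u₀ k) v t

-- t ∈ {31, 2}*   (letter 1 = zero, 2 = suc zero, 3 = suc (suc zero))
data In31-2* : List (Fin 3) → Set where
  nil  : In31-2* []
  c31  : ∀ {t} → In31-2* t → In31-2* (suc (suc zero) ∷ zero ∷ t)
  c2   : ∀ {t} → In31-2* t → In31-2* (suc zero ∷ t)

-- Track the sign of the ranking r[1] r[2] ⋯ r[k], read as a permutation, while a word is encoded.
-- Appending r[j] moves that letter to the end of the ranking, changing the sign by the parity of
-- k − j; for even k a block 2 keeps the sign and a block 31 flips it twice, so at every block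
-- boundary the ranking has the sign of k 1 2 ⋯ (k−1), the ranking of u₀. A letter z is written as
-- r[2] of such a ranking, as r[3], or as r[1] of a ranking of the opposite sign; and the k − 2
-- letters before z are r[3] ⋯ r[k]. Hence a factor u of k − 1 distinct letters ends in r[2] or
-- r[1] (r[3] would repeat a letter), and completing it by its missing letter x gives a permutation
-- x u whose sign is always the same. But x u and x u^R differ by the reversal of k − 1 letters,
-- which has (k−1 choose 2) inversions, an odd number when k ≡ 0 mod 4.

module Submission where

open import Defs
open import Algebra.Bundles using (CommutativeMonoid; CommutativeRing)
open import Data.Bool using (Bool; true; false; not; _xor_)
open import Data.Bool.Properties
  using (xor-assoc; xor-comm; xor-same; xor-identityʳ; xor-inverseʳ; xor-∧-commutativeRing;
         not-involutive; not-distribˡ-xor; not-distribʳ-xor; not-¬)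
open import Data.Fin using (Fin; zero; suc; toℕ; fromℕ; _≟_)
import Data.Fin as Fin
open import Data.Fin.Properties using (<-cmp; injective⇒≤; toℕ-injective; toℕ-fromℕ)
open import Data.List
  using (List; []; _∷_; _++_; [_]; _∷ʳ_; length; reverse; lookup; map; drop; take; filter; tabulate;
         allFin; initLast; _∷ʳ′_)
open import Data.List.Membership.Propositional using (_∈_; _∉_)
open import Data.List.Membership.Propositional.Properties using (∈-lookup; ∈-++⁺ʳ; ∈-++⁻; ∈-filter⁻)
open import Data.List.Properties
  using (unfold-reverse; length-reverse; length-++; length-map; length-tabulate; length-++-≤ʳ;
         ∷-injective; ∷-injectiveʳ; ++-assoc; ++-identityʳ; take++drop≡id; filter-accept; filter-reject)
open import Data.List.Relation.Binary.Disjoint.Propositional using (Disjoint)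
open import Data.List.Relation.Binary.Permutation.Propositional.Properties using (∈-resp-↭; ++⁺ˡ; ∷↭∷ʳ)
open import Data.List.Relation.Binary.Subset.Propositional using (_⊆_)
open import Data.List.Relation.Unary.All as All using ([]; _∷_)
open import Data.List.Relation.Unary.All.Properties using (¬Any⇒All¬)
open import Data.List.Relation.Unary.Any using (here; there; any?)
import Data.List.Relation.Unary.Any.Properties as Any
open import Data.List.Relation.Unary.Unique.Propositional using (Unique; []; _∷_)
open import Data.List.Relation.Unary.Unique.Propositional.Properties
  using (Unique[x∷xs]⇒x∉xs; ++⁺; map⁺; allFin⁺; filter⁺)
open import Data.Nat using (ℕ; zero; suc; _+_; _*_; _≤_; _<_; _<?_; _∸_; s≤s)
open import Data.Nat.Divisibility using (_∣_; divides)
open import Data.Nat.Properties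
  using (+-identityʳ; +-comm; +-suc; m≤m+n; 1+n≰n; <-irrefl; suc-injective; m+n∸n≡m)
open import Data.Product using (∃; Σ; _×_; _,_; proj₁; proj₂)
open import Data.Sum using (_⊎_; inj₁; inj₂)
open import Function using (_∘_)
open import Function.Definitions using (Injective)
open import Relation.Binary using (tri<; tri≈; tri>)
open import Relation.Binary.PropositionalEquality
  using (_≡_; _≢_; refl; sym; trans; cong; cong₂; subst; module ≡-Reasoning)
open import Relation.Nullary using (¬_; does; yes; no; contradiction)
open import Relation.Nullary.Decidable using (dec-true; dec-false)
open import Algebra.Properties.CommutativeSemigroup
  (CommutativeMonoid.commutativeSemigroup (CommutativeRing.+-commutativeMonoid xor-∧-commutativeRing))
  using (interchange; x∙yz≈y∙xz)

-- Parities of natural numbers and of inversions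

-- A parity is a Boolean (true = odd); parities add by xor.
odd : ℕ → Bool
odd zero    = false
odd (suc n) = not (odd n)

oddChoose2 : ℕ → Bool
oddChoose2 zero    = false
oddChoose2 (suc n) = oddChoose2 n xor odd n

odd-*4 : ∀ q → odd (q * 4) ≡ false
odd-*4 zero    = refl
odd-*4 (suc q) = cong (not ∘ not ∘ not ∘ not) (odd-*4 q)

oddChoose2-*4 : ∀ q → oddChoose2 (q * 4) ≡ false
oddChoose2-*4 zero    = refl
oddChoose2-*4 (suc q) =
  cong₂ (λ c o → (((c xor o) xor not o) xor not (not o)) xor not (not (not o)))
        (oddChoose2-*4 q) (odd-*4 q)

oddChoose2-3+*4 : ∀ q → oddChoose2 (3 + q * 4) ≡ true
oddChoose2-3+*4 q =
  cong₂ (λ c o → ((c xor o) xor not o) xor not (not o)) (oddChoose2-*4 q) (odd-*4 q)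

module _ {k : ℕ} where

  infix 5 _<ᵇ_

  _<ᵇ_ : Fin k → Fin k → Bool
  a <ᵇ b = does (a Fin.<? b)

  <ᵇ-flip : ∀ {a b} → a ≢ b → b <ᵇ a ≡ not (a <ᵇ b)
  <ᵇ-flip {a} {b} a≢b with <-cmp a b
  ... | tri< a<b _ b≮a = trans (dec-false (b Fin.<? a) b≮a) (cong not (sym (dec-true (a Fin.<? b) a<b)))
  ... | tri≈ _ a≡b _   = contradiction a≡b a≢b
  ... | tri> a≮b _ b<a = trans (dec-true (b Fin.<? a) b<a) (cong not (sym (dec-false (a Fin.<? b) a≮b)))

  below above : Fin k → List (Fin k) → Bool
  below x []       = false
  below x (y ∷ ys) = (y <ᵇ x) xor below x ys
  above x []       = false
  above x (y ∷ ys) = (x <ᵇ y) xor above x ys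

  inversionParity : List (Fin k) → Bool
  inversionParity []       = false
  inversionParity (y ∷ ys) = below y ys xor inversionParity ys

  below-++ : ∀ x xs ys → below x (xs ++ ys) ≡ below x xs xor below x ys
  below-++ x []       ys = refl
  below-++ x (y ∷ xs) ys =
    trans (cong ((y <ᵇ x) xor_) (below-++ x xs ys)) (sym (xor-assoc (y <ᵇ x) _ _))

  below-++-comm : ∀ x xs ys → below x (xs ++ ys) ≡ below x (ys ++ xs)
  below-++-comm x xs ys =
    trans (below-++ x xs ys) (trans (xor-comm (below x xs) _) (sym (below-++ x ys xs)))

  below-xor-above : ∀ a ys → a ∉ ys → below a ys xor above a ys ≡ odd (length ys)
  below-xor-above a []       _    = refl
  below-xor-above a (y ∷ ys) a∉ys = begin
      ((y <ᵇ a) xor below a ys) xor ((a <ᵇ y) xor above a ys)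
    ≡⟨ interchange (y <ᵇ a) _ _ _ ⟩
      ((y <ᵇ a) xor (a <ᵇ y)) xor (below a ys xor above a ys)
    ≡⟨ cong₂ _xor_ flip (below-xor-above a ys (a∉ys ∘ there)) ⟩
      true xor odd (length ys)
    ∎
    where
    open ≡-Reasoning
    flip : (y <ᵇ a) xor (a <ᵇ y) ≡ true
    flip = trans (cong ((y <ᵇ a) xor_) (<ᵇ-flip (a∉ys ∘ here ∘ sym))) (xor-inverseʳ (y <ᵇ a))

  inversionParity-∷ʳ : ∀ ys a → inversionParity (ys ∷ʳ a) ≡ inversionParity ys xor above a ys
  inversionParity-∷ʳ []       a = refl
  inversionParity-∷ʳ (y ∷ ys) a = begin
      below y (ys ∷ʳ a) xor inversionParity (ys ∷ʳ a)
    ≡⟨ cong₂ _xor_ (below-++ y ys [ a ]) (inversionParity-∷ʳ ys a) ⟩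
      (below y ys xor ((a <ᵇ y) xor false)) xor (inversionParity ys xor above a ys)
    ≡⟨ cong (λ c → (below y ys xor c) xor _) (xor-identityʳ (a <ᵇ y)) ⟩
      (below y ys xor (a <ᵇ y)) xor (inversionParity ys xor above a ys)
    ≡⟨ interchange (below y ys) _ _ _ ⟩
      (below y ys xor inversionParity ys) xor ((a <ᵇ y) xor above a ys)
    ∎
    where open ≡-Reasoning

  inversionParity-rotate : ∀ xs a ys → a ∉ ys →
    inversionParity (xs ++ ys ∷ʳ a) ≡ inversionParity (xs ++ a ∷ ys) xor odd (length ys)
  inversionParity-rotate [] a ys a∉ys = begin
      inversionParity (ys ∷ʳ a)
    ≡⟨ inversionParity-∷ʳ ys a ⟩
      p xor r
    ≡⟨ cong (_xor (p xor r)) (xor-same c) ⟨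
      (c xor c) xor (p xor r)
    ≡⟨ interchange c c p r ⟩
      (c xor p) xor (c xor r)
    ≡⟨ cong ((c xor p) xor_) (below-xor-above a ys a∉ys) ⟩
      inversionParity (a ∷ ys) xor odd (length ys)
    ∎
    where
    open ≡-Reasoning
    c = below a ys
    p = inversionParity ys
    r = above a ys
  inversionParity-rotate (x ∷ xs) a ys a∉ys = begin
      below x (xs ++ ys ∷ʳ a) xor inversionParity (xs ++ ys ∷ʳ a)
    ≡⟨ cong₂ _xor_ below-moved (inversionParity-rotate xs a ys a∉ys) ⟩
      below x (xs ++ a ∷ ys) xor (inversionParity (xs ++ a ∷ ys) xor odd (length ys))
    ≡⟨ xor-assoc (below x (xs ++ a ∷ ys)) _ _ ⟨
      inversionParity (x ∷ xs ++ a ∷ ys) xor odd (length ys)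
    ∎
    where
    open ≡-Reasoning
    below-moved : below x (xs ++ ys ∷ʳ a) ≡ below x (xs ++ a ∷ ys)
    below-moved = begin
        below x (xs ++ ys ∷ʳ a)          ≡⟨ below-++ x xs (ys ∷ʳ a) ⟩
        below x xs xor below x (ys ∷ʳ a) ≡⟨ cong (below x xs xor_) (below-++-comm x ys [ a ]) ⟩
        below x xs xor below x (a ∷ ys)  ≡⟨ below-++ x xs (a ∷ ys) ⟨
        below x (xs ++ a ∷ ys)           ∎

  inversionParity-swap : ∀ {a b} T → a ≢ b →
    inversionParity (a ∷ b ∷ T) ≡ not (inversionParity (b ∷ a ∷ T))
  inversionParity-swap {a} {b} T a≢b = begin
      ((b <ᵇ a) xor below a T) xor (below b T xor p)
    ≡⟨ xor-assoc (b <ᵇ a) _ _ ⟩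
      (b <ᵇ a) xor (below a T xor (below b T xor p))
    ≡⟨ cong (_xor (below a T xor (below b T xor p))) (<ᵇ-flip a≢b) ⟩
      not (a <ᵇ b) xor (below a T xor (below b T xor p))
    ≡⟨ not-distribˡ-xor (a <ᵇ b) _ ⟨
      not ((a <ᵇ b) xor (below a T xor (below b T xor p)))
    ≡⟨ cong (λ s → not ((a <ᵇ b) xor s)) (x∙yz≈y∙xz (below a T) (below b T) p) ⟩
      not ((a <ᵇ b) xor (below b T xor (below a T xor p)))
    ≡⟨ cong not (xor-assoc (a <ᵇ b) _ _) ⟨
      not (((a <ᵇ b) xor below b T) xor (below a T xor p))
    ∎
    where
    open ≡-Reasoning
    p = inversionParity T

  below-reverse : ∀ x u → below x (reverse u) ≡ below x u
  below-reverse x []      = refl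
  below-reverse x (a ∷ u) = begin
      below x (reverse (a ∷ u))        ≡⟨ cong (below x) (unfold-reverse a u) ⟩
      below x (reverse u ∷ʳ a)         ≡⟨ below-++-comm x (reverse u) [ a ] ⟩
      (a <ᵇ x) xor below x (reverse u) ≡⟨ cong ((a <ᵇ x) xor_) (below-reverse x u) ⟩
      below x (a ∷ u)                  ∎
    where open ≡-Reasoning

  inversionParity-reverse : ∀ u → Unique u →
    inversionParity (reverse u) ≡ inversionParity u xor oddChoose2 (length u)
  inversionParity-reverse []      _ = refl
  inversionParity-reverse (a ∷ u) (a∉u ∷ u!) = begin
      inversionParity (reverse (a ∷ u))
    ≡⟨ cong inversionParity (unfold-reverse a u) ⟩
      inversionParity (reverse u ∷ʳ a)
    ≡⟨ inversionParity-rotate [] a (reverse u) (Unique[x∷xs]⇒x∉xs (a∉u ∷ u!) ∘ Any.reverse⁻) ⟩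
      (below a (reverse u) xor inversionParity (reverse u)) xor odd (length (reverse u))
    ≡⟨ cong₂ (λ c p → (c xor p) xor odd (length (reverse u)))
             (below-reverse a u) (inversionParity-reverse u u!) ⟩
      (c xor (p xor t)) xor odd (length (reverse u))
    ≡⟨ cong (λ m → (c xor (p xor t)) xor odd m) (length-reverse u) ⟩
      (c xor (p xor t)) xor o
    ≡⟨ xor-assoc c _ o ⟩
      c xor ((p xor t) xor o)
    ≡⟨ cong (c xor_) (xor-assoc p t o) ⟩
      c xor (p xor (t xor o))
    ≡⟨ xor-assoc c p _ ⟨
      inversionParity (a ∷ u) xor oddChoose2 (length (a ∷ u))
    ∎
    where
    open ≡-Reasoning
    c = below a u
    p = inversionParity u
    t = oddChoose2 (length u)
    o = odd (length u)

-- Splitting lists, and lists without repetition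

module _ {A : Set} where

  Unique-reverse : ∀ {xs : List A} → Unique xs → Unique (reverse xs)
  Unique-reverse {[]}     _            = []
  Unique-reverse {x ∷ xs} (x∉ ∷ xs!) rewrite unfold-reverse x xs =
    ++⁺ (Unique-reverse xs!) ([] ∷ []) x∉reverse
    where
    x∉reverse : Disjoint (reverse xs) [ x ]
    x∉reverse (x∈ , here refl) = Unique[x∷xs]⇒x∉xs (x∉ ∷ xs!) (Any.reverse⁻ x∈)

  ∉-∷ʳ : ∀ {y x : A} {xs} → y ∉ xs → y ≢ x → y ∉ xs ∷ʳ x
  ∉-∷ʳ {xs = xs} y∉xs y≢x y∈ with ∈-++⁻ xs y∈
  ... | inj₁ y∈xs       = y∉xs y∈xs
  ... | inj₂ (here y≡x) = y≢x y≡x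

  Unique-∷ʳ⇒∉ : ∀ xs {z : A} → Unique (xs ∷ʳ z) → z ∉ xs
  Unique-∷ʳ⇒∉ (x ∷ xs) (x≢ ∷ _)  (here refl) = All.lookup x≢ (∈-++⁺ʳ xs (here refl)) refl
  Unique-∷ʳ⇒∉ (x ∷ xs) (_  ∷ u!) (there z∈) = Unique-∷ʳ⇒∉ xs u! z∈

  Unique-++-∷⇒∉ : ∀ xs {x : A} {ys} → Unique (xs ++ x ∷ ys) → x ∉ ys
  Unique-++-∷⇒∉ []       u!       = Unique[x∷xs]⇒x∉xs u!
  Unique-++-∷⇒∉ (_ ∷ xs) (_ ∷ u!) = Unique-++-∷⇒∉ xs u!

  lookup-injective : ∀ {l : List A} → Unique l → ∀ i j → lookup l i ≡ lookup l j → i ≡ j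
  lookup-injective {_ ∷ _} _  zero    zero    _  = refl
  lookup-injective {_ ∷ l} u! zero    (suc j) eq =
    contradiction (subst (_∈ l) (sym eq) (∈-lookup j)) (Unique[x∷xs]⇒x∉xs u!)
  lookup-injective {_ ∷ l} u! (suc i) zero    eq =
    contradiction (subst (_∈ l) eq (∈-lookup i)) (Unique[x∷xs]⇒x∉xs u!)
  lookup-injective {_ ∷ _} (_ ∷ u!) (suc i) (suc j) eq = cong suc (lookup-injective u! i j eq)

  ++-prefix-length : ∀ (as bs cs ds : List A) → length as ≡ length cs → as ++ bs ≡ cs ++ ds → as ≡ cs
  ++-prefix-length []       _  []       _  _  _  = refl
  ++-prefix-length (a ∷ as) bs (c ∷ cs) ds |as| eq with ∷-injective eq
  ... | refl , eq′ = cong (a ∷_) (++-prefix-length as bs cs ds (suc-injective |as|) eq′)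

  ++-split : ∀ (as bs cs ds : List A) → as ++ bs ≡ cs ++ ds → length as ≤ length cs →
             ∃ λ es → cs ≡ as ++ es × bs ≡ es ++ ds
  ++-split []       bs cs       ds eq _          = cs , refl , eq
  ++-split (a ∷ as) bs (c ∷ cs) ds eq (s≤s |as|) with ∷-injective eq
  ... | refl , eq′ with ++-split as bs cs ds eq′ |as|
  ...   | es , cs≡ , bs≡ = es , cong (a ∷_) cs≡ , bs≡

  drop-length-++ : ∀ (as bs : List A) → drop (length as) (as ++ bs) ≡ bs
  drop-length-++ []       bs = refl
  drop-length-++ (_ ∷ as) bs = drop-length-++ as bs

  drop-suffix : ∀ (as bs : List A) → drop (length (as ++ bs) ∸ length bs) (as ++ bs) ≡ bs
  drop-suffix as bs rewrite length-++ as {bs} | m+n∸n≡m (length as) (length bs) = drop-length-++ as bs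

  ⊆-after-occurrence : ∀ xs {a : A} ys pre suf → xs ++ a ∷ ys ≡ pre ++ suf → a ∉ suf → suf ⊆ ys
  ⊆-after-occurrence []       ys []        suf refl a∉ _   = contradiction (here refl) a∉
  ⊆-after-occurrence []       ys (_ ∷ pre) suf refl _  v∈  = ∈-++⁺ʳ pre v∈
  ⊆-after-occurrence (x ∷ xs) ys []        suf refl a∉ _   =
    contradiction (there (∈-++⁺ʳ xs (here refl))) a∉
  ⊆-after-occurrence (x ∷ xs) ys (_ ∷ pre) suf eq   a∉ v∈  =
    ⊆-after-occurrence xs ys pre suf (∷-injectiveʳ eq) a∉ v∈

module _ {k : ℕ} where

  Unique⇒length≤ : ∀ {l : List (Fin k)} → Unique l → length l ≤ k
  Unique⇒length≤ l! = injective⇒≤ (λ {i} {j} → lookup-injective l! i j)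

  Unique∧length≡⇒∈ : ∀ {l : List (Fin k)} → Unique l → length l ≡ k → ∀ y → y ∈ l
  Unique∧length≡⇒∈ {l} l! |l| y with any? (y ≟_) l
  ... | yes y∈l = y∈l
  ... | no  y∉l =
    contradiction (subst (λ m → suc m ≤ k) |l| (Unique⇒length≤ (¬Any⇒All¬ l y∉l ∷ l!))) 1+n≰n

missing-unique : ∀ {m} {l : List (Fin (suc m))} → Unique l → length l ≡ m →
                 ∀ {x y} → x ∉ l → y ∉ l → x ≡ y
missing-unique {l = l} l! |l| {x} {y} x∉l y∉l
  with Unique∧length≡⇒∈ (¬Any⇒All¬ l x∉l ∷ l!) (cong suc |l|) y
... | here y≡x  = sym y≡x
... | there y∈l = contradiction y∈l y∉l

CompletionOfParity : ∀ {k} → Bool → List (Fin k) → Set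
CompletionOfParity b l = ∃ λ x → x ∉ l × inversionParity (x ∷ l) ≡ b

reverse-has-no-completion : ∀ {m b} (u : List (Fin (suc m))) → Unique u → length u ≡ m →
                            oddChoose2 m ≡ true → CompletionOfParity b u → ¬ CompletionOfParity b (reverse u)
reverse-has-no-completion {m} {b} u u! |u| odd-pairs (x , x∉u , x∷u≡b) (y , y∉u′ , y∷u′≡b)
  with missing-unique u! |u| x∉u (y∉u′ ∘ Any.reverse⁺)
... | refl = not-¬ refl (trans (sym y∷u′≡b) (begin
    below x (reverse u) xor inversionParity (reverse u)
  ≡⟨ cong₂ _xor_ (below-reverse x u) (inversionParity-reverse u u!) ⟩
    below x u xor (inversionParity u xor oddChoose2 (length u))
  ≡⟨ cong (λ n → below x u xor (inversionParity u xor oddChoose2 n)) |u| ⟩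
    below x u xor (inversionParity u xor oddChoose2 m)
  ≡⟨ cong (λ t → below x u xor (inversionParity u xor t)) odd-pairs ⟩
    below x u xor (inversionParity u xor true)
  ≡⟨ cong (below x u xor_) (xor-comm (inversionParity u) true) ⟩
    below x u xor not (inversionParity u)
  ≡⟨ not-distribʳ-xor (below x u) _ ⟨
    not (inversionParity (x ∷ u))
  ≡⟨ cong not x∷u≡b ⟩
    not b
  ∎))
  where
  open ≡-Reasoning

-- The initial word u₀ and rankings

length-filter-tabulate : ∀ {K} n (f : Fin n → Fin K) c → (∀ i → toℕ (f i) ≡ c + toℕ i) → c + n ≡ K →
                         length (filter (λ x → suc (toℕ x) <? K) (tabulate f)) ≡ n ∸ 1
length-filter-tabulate zero _ _ _ _ = refl
length-filter-tabulate {K} (suc zero) f c f≡ c+1≡K =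
  cong length (filter-reject (λ x → suc (toℕ x) <? K) last-rejected)
  where
  last-rejected : ¬ suc (toℕ (f zero)) < K
  last-rejected rewrite f≡ zero | +-identityʳ c | sym c+1≡K | +-comm c 1 = 1+n≰n
length-filter-tabulate {K} (suc (suc n)) f c f≡ c+n≡K =
  trans (cong length (filter-accept (λ x → suc (toℕ x) <? K) first-accepted))
        (cong suc (length-filter-tabulate (suc n) (f ∘ suc) (suc c)
                     (λ i → trans (f≡ (suc i)) (+-suc c (toℕ i)))
                     (trans (sym (+-suc c (suc n))) c+n≡K)))
  where
  first-accepted : suc (toℕ (f zero)) < K
  first-accepted rewrite f≡ zero | +-identityʳ c | sym c+n≡K | +-suc c (suc n) | +-suc c n =
    s≤s (s≤s (m≤m+n c n))

length-u₀ : ∀ k → length (u₀ k) ≡ k ∸ 1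
length-u₀ k = length-filter-tabulate k (λ x → x) 0 (λ _ → refl) refl

Unique-u₀ : ∀ k → Unique (u₀ k)
Unique-u₀ k = filter⁺ _ (allFin⁺ k)

fromℕ∉u₀ : ∀ n → fromℕ n ∉ u₀ (suc n)
fromℕ∉u₀ n last∈ with ∈-filter⁻ (λ x → suc (toℕ x) <? suc n) {xs = allFin (suc n)} last∈
... | _ , last<k rewrite toℕ-fromℕ n = <-irrefl refl last<k

¬LastOccLater-suffix : ∀ {k} {q pre suf : List (Fin k)} {P Q} →
                       q ≡ pre ++ suf → Q ∈ suf → P ∉ suf → ¬ LastOccLater q P Q
¬LastOccLater-suffix {pre = pre} {suf} q≡ Q∈ P∉ (xs , ys , q≡′ , Q∉ys) =
  Q∉ys (⊆-after-occurrence xs ys pre suf (trans (sym q≡′) q≡) P∉ Q∈)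

-- k = n + 3 is even. A ranking is a permutation r of Fin k, whose values r i₁, r i₂, r i₃ are the
-- paper's r[1], r[2], r[3], and parity r is its sign.
module Rankings (n : ℕ) (n-odd : odd n ≡ true) where

  k : ℕ
  k = 3 + n

  i₁ i₂ i₃ : Fin k
  i₁ = zero
  i₂ = suc zero
  i₃ = suc (suc zero)

  ranks ranks≥3 ranks≥4 : (Fin k → Fin k) → List (Fin k)
  ranks   r = map r (allFin k)
  ranks≥3 r = map r (drop 2 (allFin k))
  ranks≥4 r = map r (drop 3 (allFin k))

  parity : (Fin k → Fin k) → Bool
  parity r = inversionParity (ranks r)

  length-ranks≥4 : ∀ r → length (ranks≥4 r) ≡ n
  length-ranks≥4 r =
    trans (length-map r (drop 3 (allFin k)))
          (length-tabulate {n = n} (λ (i : Fin n) → suc (suc (suc i))))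

  module _ {r : Fin k → Fin k} (r-injective : Injective _≡_ _≡_ r) where

    Unique-ranks : Unique (ranks r)
    Unique-ranks = map⁺ r-injective (allFin⁺ k)

    ∈-ranks : ∀ y → y ∈ ranks r
    ∈-ranks = Unique∧length≡⇒∈ Unique-ranks
                (trans (length-map r (allFin k)) (length-tabulate {n = k} (λ (i : Fin k) → i)))

    r₁∉tail : r i₁ ∉ r i₂ ∷ ranks≥3 r
    r₁∉tail = Unique[x∷xs]⇒x∉xs Unique-ranks

    r₂∉tail : r i₂ ∉ ranks≥3 r
    r₂∉tail with Unique-ranks
    ... | _ ∷ U = Unique[x∷xs]⇒x∉xs U

  module _ {p : List (Fin k)} {r : Fin k → Fin k} (rk : IsRanking p r) where

    ranking-injective : Injective _≡_ _≡_ r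
    ranking-injective = let (_ , inj , _) = rk in inj

    ranking-lastOccLater : LastOccLater p (r i₂) (r i₁)
    ranking-lastOccLater = let (_ , _ , _ , _ , later) = rk in later i₁ i₂ refl refl

    ranking-suffix : ∀ {pre s} → p ≡ pre ++ s → length s ≡ suc n → ranks≥3 r ≡ s
    ranking-suffix {pre} {s} refl |s| = let (_ , _ , _ , suffix , _) = rk in
      trans (sym suffix)
            (subst (λ m → drop (length (pre ++ s) ∸ m) (pre ++ s) ≡ s) |s| (drop-suffix pre s))

    ranking-split : ∃ λ pre → p ≡ pre ++ ranks≥3 r
    ranking-split = let (_ , _ , _ , suffix , _) = rk in
      take (length p ∸ suc n) p ,
      trans (sym (take++drop≡id (length p ∸ suc n) p)) (cong (take (length p ∸ suc n) p ++_) suffix)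

  ranking-of-short-word : ∀ {l r} → IsRanking l r → length l ≡ 2 + n → l ≡ r i₂ ∷ ranks≥3 r
  ranking-of-short-word {h ∷ t} {r} rk |l| with ranking-lastOccLater rk
  ... | xs , ys , l≡ , _ with ranking-suffix rk {pre = [ h ]} refl (cong (λ m → m ∸ 1) |l|)
  ...   | refl with subst (r i₂ ∈_) (sym l≡) (∈-++⁺ʳ xs (here refl))
  ...     | here r₂≡h  = cong (_∷ ranks≥3 r) (sym r₂≡h)
  ...     | there r₂∈t = contradiction r₂∈t (r₂∉tail (ranking-injective rk))

  ranks-determined : ∀ {q r P Q} → IsRanking q r → (∀ y → y ∈ P ∷ Q ∷ ranks≥3 r) →
                     ¬ LastOccLater q P Q → ranks r ≡ P ∷ Q ∷ ranks≥3 r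
  ranks-determined {r = r} {P} {Q} rk covers P-not-later =
    decide (P-or-Q (r₁∉tail inj ∘ there) (covers (r i₁))) (P-or-Q (r₂∉tail inj) (covers (r i₂)))
    where
    inj = ranking-injective rk
    r₁≢r₂ : r i₁ ≢ r i₂
    r₁≢r₂ = r₁∉tail inj ∘ here
    P-or-Q : ∀ {y} → y ∉ ranks≥3 r → y ∈ P ∷ Q ∷ ranks≥3 r → y ≡ P ⊎ y ≡ Q
    P-or-Q _  (here y≡P)         = inj₁ y≡P
    P-or-Q _  (there (here y≡Q)) = inj₂ y≡Q
    P-or-Q y∉ (there (there y∈)) = contradiction y∈ y∉
    decide : r i₁ ≡ P ⊎ r i₁ ≡ Q → r i₂ ≡ P ⊎ r i₂ ≡ Q → ranks r ≡ P ∷ Q ∷ ranks≥3 r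
    decide (inj₁ refl) (inj₂ refl) = refl
    decide (inj₁ refl) (inj₁ r₂≡) = contradiction (sym r₂≡) r₁≢r₂
    decide (inj₂ refl) (inj₂ r₂≡) = contradiction (sym r₂≡) r₁≢r₂
    decide (inj₂ refl) (inj₁ refl) = contradiction (ranking-lastOccLater rk) P-not-later

  split-after-append : ∀ {p r} → IsRanking p r → ∀ x → ∃ λ pre → p ∷ʳ x ≡ pre ++ r i₃ ∷ ranks≥4 r ∷ʳ x
  split-after-append {r = r} rk x with ranking-split rk
  ... | pre , refl = pre , ++-assoc pre (ranks≥3 r) [ x ]

  ranks≥3-after-append : ∀ {p r r′ x} → IsRanking p r → IsRanking (p ∷ʳ x) r′ →
                         ranks≥3 r′ ≡ ranks≥4 r ∷ʳ x
  ranks≥3-after-append {r = r} {x = x} rk rk′ with split-after-append rk x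
  ... | pre , p∷ʳx≡ =
    ranking-suffix rk′ {pre = pre ∷ʳ r i₃}
      (trans p∷ʳx≡ (sym (++-assoc pre [ r i₃ ] (ranks≥4 r ∷ʳ x)))) |T∷ʳx|
    where
    |T∷ʳx| : length (ranks≥4 r ∷ʳ x) ≡ suc n
    |T∷ʳx| = trans (length-++ (ranks≥4 r)) (trans (cong (_+ 1) (length-ranks≥4 r)) (+-comm n 1))

  -- Appending x = r[j] moves x to the end of the ranking, provided the two letters P, Q that the
  -- new suffix leaves out keep their order.
  parity-after-append : ∀ {p r r′} xs x ys {P Q} →
    ranks r ≡ xs ++ x ∷ ys → xs ++ ys ≡ P ∷ Q ∷ ranks≥4 r →
    IsRanking p r → IsRanking (p ∷ʳ x) r′ → ¬ LastOccLater (p ∷ʳ x) P Q →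
    parity r′ ≡ parity r xor odd (length ys)
  parity-after-append {r = r} {r′} xs x ys {P} {Q} ranks≡ xs++ys≡ rk rk′ P-not-later = begin
      parity r′
    ≡⟨ cong inversionParity ranks′≡ ⟩
      inversionParity (xs ++ ys ∷ʳ x)
    ≡⟨ inversionParity-rotate xs x ys (Unique-++-∷⇒∉ xs (subst Unique ranks≡ (Unique-ranks inj))) ⟩
      inversionParity (xs ++ x ∷ ys) xor odd (length ys)
    ≡⟨ cong (λ l → inversionParity l xor odd (length ys)) ranks≡ ⟨
      parity r xor odd (length ys)
    ∎
    where
    open ≡-Reasoning
    inj = ranking-injective rk
    rearranged : P ∷ Q ∷ ranks≥3 r′ ≡ xs ++ ys ∷ʳ x
    rearranged = begin
        P ∷ Q ∷ ranks≥3 r′     ≡⟨ cong (λ l → P ∷ Q ∷ l) (ranks≥3-after-append rk rk′) ⟩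
        P ∷ Q ∷ ranks≥4 r ∷ʳ x ≡⟨ cong (_∷ʳ x) xs++ys≡ ⟨
        (xs ++ ys) ∷ʳ x        ≡⟨ ++-assoc xs ys [ x ] ⟩
        xs ++ ys ∷ʳ x          ∎
    covers : ∀ y → y ∈ P ∷ Q ∷ ranks≥3 r′
    covers y = subst (y ∈_) (sym rearranged)
                 (∈-resp-↭ (++⁺ˡ xs (∷↭∷ʳ x ys)) (subst (y ∈_) ranks≡ (∈-ranks inj y)))
    ranks′≡ : ranks r′ ≡ xs ++ ys ∷ʳ x
    ranks′≡ = trans (ranks-determined rk′ covers P-not-later) rearranged

  odd-length-ranks≥4 : ∀ r → odd (length (ranks≥4 r)) ≡ true
  odd-length-ranks≥4 r = trans (cong odd (length-ranks≥4 r)) n-odd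

  parity-after-r₁ : ∀ {p r r′} → IsRanking p r → IsRanking (p ∷ʳ r i₁) r′ → parity r′ ≡ not (parity r)
  parity-after-r₁ {p} {r} {r′} rk rk′ = begin
      parity r′
    ≡⟨ parity-after-append [] (r i₁) (r i₂ ∷ r i₃ ∷ ranks≥4 r) refl refl rk rk′ r₂-not-later ⟩
      parity r xor not (not (odd (length (ranks≥4 r))))
    ≡⟨ cong (λ o → parity r xor not (not o)) (odd-length-ranks≥4 r) ⟩
      parity r xor true
    ≡⟨ xor-comm (parity r) true ⟩
      not (parity r)
    ∎
    where
    open ≡-Reasoning
    inj = ranking-injective rk
    r₂-not-later : ¬ LastOccLater (p ∷ʳ r i₁) (r i₂) (r i₃)
    r₂-not-later = let (_ , p∷ʳr₁≡) = split-after-append rk (r i₁) in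
      ¬LastOccLater-suffix p∷ʳr₁≡ (here refl) (∉-∷ʳ (r₂∉tail inj) (r₁∉tail inj ∘ here ∘ sym))

  parity-after-r₂ : ∀ {p r r′} → IsRanking p r → IsRanking (p ∷ʳ r i₂) r′ → parity r′ ≡ parity r
  parity-after-r₂ {p} {r} {r′} rk rk′ = begin
      parity r′
    ≡⟨ parity-after-append [ r i₁ ] (r i₂) (r i₃ ∷ ranks≥4 r) refl refl rk rk′ r₁-not-later ⟩
      parity r xor not (odd (length (ranks≥4 r)))
    ≡⟨ cong (λ o → parity r xor not o) (odd-length-ranks≥4 r) ⟩
      parity r xor false
    ≡⟨ xor-identityʳ (parity r) ⟩
      parity r
    ∎
    where
    open ≡-Reasoning
    inj = ranking-injective rk
    r₁-not-later : ¬ LastOccLater (p ∷ʳ r i₂) (r i₁) (r i₃)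
    r₁-not-later = let (_ , p∷ʳr₂≡) = split-after-append rk (r i₂) in
      ¬LastOccLater-suffix p∷ʳr₂≡ (here refl) (∉-∷ʳ (r₁∉tail inj ∘ there) (r₁∉tail inj ∘ here))

  parity-after-r₃ : ∀ {p r r′} → IsRanking p r → IsRanking (p ∷ʳ r i₃) r′ → parity r′ ≡ not (parity r)
  parity-after-r₃ {p} {r} {r′} rk rk′ = begin
      parity r′
    ≡⟨ parity-after-append (r i₁ ∷ [ r i₂ ]) (r i₃) (ranks≥4 r) refl refl rk rk′ r₁-not-later ⟩
      parity r xor odd (length (ranks≥4 r))
    ≡⟨ cong (parity r xor_) (odd-length-ranks≥4 r) ⟩
      parity r xor true
    ≡⟨ xor-comm (parity r) true ⟩
      not (parity r)
    ∎
    where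
    open ≡-Reasoning
    inj = ranking-injective rk
    r₁-not-later : ¬ LastOccLater (p ∷ʳ r i₃) (r i₁) (r i₂)
    r₁-not-later with ranking-lastOccLater rk
    ... | xs , ys , p≡ , r₁∉ys =
      ¬LastOccLater-suffix (trans (cong (_∷ʳ r i₃) p≡) (++-assoc xs (r i₂ ∷ ys) [ r i₃ ]))
        (here refl) (∉-∷ʳ r₁∉r₂∷ys (r₁∉tail inj ∘ there ∘ here))
      where
      r₁∉r₂∷ys : r i₁ ∉ r i₂ ∷ ys
      r₁∉r₂∷ys (here r₁≡r₂) = r₁∉tail inj (here r₁≡r₂)
      r₁∉r₂∷ys (there r₁∈) = r₁∉ys r₁∈

  -- The encoding invariant

  NextLetter : List (Fin k) → Fin 3 → Fin k → Set
  NextLetter p c x = Σ (Fin k → Fin k) λ r → IsRanking p r × Σ (Fin k) λ j → toℕ j ≡ toℕ c × x ≡ r j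

  HasParity : Bool → List (Fin k) → Set
  HasParity b p = ∀ r → IsRanking p r → parity r ≡ b

  -- The ways a letter z can follow q when the ranking has parity b at every block boundary:
  -- as r[2] (block 2), as r[3] (first letter of 31), or as r[1] after the 3 flipped the sign.
  Emission : Bool → List (Fin k) → Fin k → Set
  Emission b q z = Σ (Fin k → Fin k) λ r → IsRanking q r ×
    ((z ≡ r i₂ × parity r ≡ b) ⊎ z ≡ r i₃ ⊎ (z ≡ r i₁ × parity r ≡ not b))

  block-2 : ∀ {b p x} → HasParity b p → NextLetter p (suc zero) x →
            Emission b p x × HasParity b (p ∷ʳ x)
  block-2 good (r , rk , j , j≡1 , refl) with toℕ-injective {j = i₂} j≡1
  ... | refl = (r , rk , inj₁ (refl , good r rk)) ,
               (λ r′ rk′ → trans (parity-after-r₂ rk rk′) (good r rk))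

  block-31 : ∀ {b p x y} → HasParity b p → NextLetter p (suc (suc zero)) x → NextLetter (p ∷ʳ x) zero y →
             Emission b p x × Emission b (p ∷ʳ x) y × HasParity b (p ∷ʳ x ∷ʳ y)
  block-31 {b} good (r , rk , j , j≡2 , refl) (r′ , rk′ , j′ , j′≡0 , refl)
    with toℕ-injective {j = i₃} j≡2 | toℕ-injective {j = i₁} j′≡0
  ... | refl | refl =
    (r , rk , inj₂ (inj₁ refl)) , (r′ , rk′ , inj₂ (inj₂ (refl , r′-flipped))) ,
    (λ r″ rk″ → trans (parity-after-r₁ rk′ rk″) (trans (cong not r′-flipped) (not-involutive b)))
    where
    r′-flipped : parity r′ ≡ not b
    r′-flipped = trans (parity-after-r₃ rk rk′) (cong not (good r rk))

  emissions : ∀ {b p v t} → HasParity b p → In31-2* t → Enc p v t →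
              ∀ v₁ z v₂ → v ≡ v₁ ++ z ∷ v₂ → Emission b (p ++ v₁) z
  emissions {v = []}    _ nil _ []      _ _ ()
  emissions {v = []}    _ nil _ (_ ∷ _) _ _ ()
  emissions {v = _ ∷ _} _ nil ()
  emissions {p = p} good (c2 _) (next , _) [] z v₂ refl =
    subst (λ q → Emission _ q z) (sym (++-identityʳ p)) (proj₁ (block-2 good next))
  emissions {p = p} good (c2 ok) (next , enc) (x ∷ v₁) z v₂ refl =
    subst (λ q → Emission _ q z) (++-assoc p [ x ] v₁)
      (emissions (proj₂ (block-2 good next)) ok enc v₁ z v₂ refl)
  emissions {v = []}        _ (c31 _) ()
  emissions {v = _ ∷ []}    _ (c31 _) (_ , ())
  emissions {p = p} {v = _ ∷ _ ∷ _} good (c31 _) (next , next′ , _) [] z v₂ refl =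
    subst (λ q → Emission _ q z) (sym (++-identityʳ p)) (proj₁ (block-31 good next next′))
  emissions {v = _ ∷ _ ∷ _} good (c31 _) (next , next′ , _) (_ ∷ []) z v₂ refl =
    proj₁ (proj₂ (block-31 good next next′))
  emissions {p = p} {v = _ ∷ _ ∷ _} good (c31 ok) (next , next′ , enc) (x ∷ y ∷ v₁) z v₂ refl =
    subst (λ q → Emission _ q z) (trans (++-assoc (p ∷ʳ x) [ y ] v₁) (++-assoc p [ x ] (y ∷ v₁)))
      (emissions (proj₂ (proj₂ (block-31 good next next′))) ok enc v₁ z v₂ refl)

  completion-∷ʳ : ∀ {b} {x z : Fin k} u′ → length u′ ≡ suc n → x ∉ u′ → x ≢ z → z ∉ u′ →
                  inversionParity (x ∷ z ∷ u′) ≡ b → CompletionOfParity b (u′ ∷ʳ z)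
  completion-∷ʳ {b} {x} {z} u′ |u′| x∉u′ x≢z z∉u′ x∷z∷u′≡b = x , ∉-∷ʳ x∉u′ x≢z , (begin
      inversionParity (x ∷ u′ ∷ʳ z)
    ≡⟨ inversionParity-rotate [ x ] z u′ z∉u′ ⟩
      inversionParity (x ∷ z ∷ u′) xor odd (length u′)
    ≡⟨ cong (λ m → inversionParity (x ∷ z ∷ u′) xor odd m) |u′| ⟩
      inversionParity (x ∷ z ∷ u′) xor not (odd n)
    ≡⟨ cong (λ o → inversionParity (x ∷ z ∷ u′) xor not o) n-odd ⟩
      inversionParity (x ∷ z ∷ u′) xor false
    ≡⟨ xor-identityʳ _ ⟩
      inversionParity (x ∷ z ∷ u′)
    ≡⟨ x∷z∷u′≡b ⟩
      b
    ∎)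
    where open ≡-Reasoning

  window-completion : ∀ {b q z pre u′} → Emission b q z → q ≡ pre ++ u′ → length u′ ≡ suc n →
                      Unique (u′ ∷ʳ z) → CompletionOfParity b (u′ ∷ʳ z)
  window-completion {b} {pre = pre} {u′} (r , rk , emitted) q≡ |u′| u′∷ʳz!
    with ranking-suffix rk {pre} {u′} q≡ |u′|
  ... | refl with emitted
  ...   | inj₁ (refl , parity≡b) =
    completion-∷ʳ u′ |u′| (r₁∉tail inj ∘ there) (r₁∉tail inj ∘ here) (r₂∉tail inj) parity≡b
    where inj = ranking-injective rk
  ...   | inj₂ (inj₁ refl) = contradiction (here refl) (Unique-∷ʳ⇒∉ u′ u′∷ʳz!)
  ...   | inj₂ (inj₂ (refl , parity≡¬b)) =
    completion-∷ʳ u′ |u′| (r₂∉tail inj) (r₁∉tail inj ∘ here ∘ sym) (r₁∉tail inj ∘ there) (begin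
        inversionParity (r i₂ ∷ r i₁ ∷ u′) ≡⟨ inversionParity-swap u′ (r₁∉tail inj ∘ here ∘ sym) ⟩
        not (parity r)                      ≡⟨ cong not parity≡¬b ⟩
        not (not b)                         ≡⟨ not-involutive b ⟩
        b                                   ∎)
    where
    open ≡-Reasoning
    inj = ranking-injective rk

  initialParity : Bool
  initialParity = inversionParity (fromℕ (2 + n) ∷ u₀ k)

  u₀-parity : HasParity initialParity (u₀ k)
  u₀-parity r rk = begin
      inversionParity (r i₁ ∷ r i₂ ∷ ranks≥3 r) ≡⟨ cong (λ l → inversionParity (r i₁ ∷ l)) u₀≡ ⟨
      inversionParity (r i₁ ∷ u₀ k)             ≡⟨ cong (λ x → inversionParity (x ∷ u₀ k)) r₁≡last ⟩
      initialParity                             ∎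
    where
    open ≡-Reasoning
    u₀≡ : u₀ k ≡ r i₂ ∷ ranks≥3 r
    u₀≡ = ranking-of-short-word rk (length-u₀ k)
    r₁≡last : r i₁ ≡ fromℕ (2 + n)
    r₁≡last = missing-unique (Unique-u₀ k) (length-u₀ k)
                (subst (r i₁ ∉_) (sym u₀≡) (r₁∉tail (ranking-injective rk))) (fromℕ∉u₀ (2 + n))

  u₀-completion : CompletionOfParity initialParity (u₀ k)
  u₀-completion = fromℕ (2 + n) , fromℕ∉u₀ (2 + n) , refl

  late-window-completion : ∀ {v t} → In31-2* t → Enc (u₀ k) v t → ∀ pre u′ z ys →
                           u₀ k ++ v ≡ (pre ++ u′) ++ z ∷ ys → length (u₀ k) ≤ length (pre ++ u′) →
                           length u′ ≡ suc n → Unique (u′ ∷ʳ z) →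
                           CompletionOfParity initialParity (u′ ∷ʳ z)
  late-window-completion {v} ok enc pre u′ z ys w≡ |u₀|≤ |u′| u!
    with ++-split (u₀ k) v (pre ++ u′) (z ∷ ys) w≡ |u₀|≤
  ... | e , pre++u′≡ , v≡ =
    window-completion (emissions u₀-parity ok enc e z ys v≡) (sym pre++u′≡) |u′| u!

  factor-completion : ∀ {w t} → HasEncoding k w t → In31-2* t →
                      ∀ u → Unique u → length u ≡ 2 + n → Factor u w → CompletionOfParity initialParity u
  factor-completion (v , refl , _) _ u _ |u| ([] , ys , w≡)
    with ++-prefix-length (u₀ k) v u ys (trans (length-u₀ k) (sym |u|)) w≡
  ... | refl = u₀-completion
  factor-completion (v , refl , enc) ok u u! |u| (x ∷ xs , ys , w≡) with initLast u
  ... | [] = contradiction |u| λ ()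
  ... | u′ ∷ʳ′ z = late-window-completion ok enc (x ∷ xs) u′ z ys w≡′ |u₀|≤ |u′| u!
    where
    w≡′ : u₀ k ++ v ≡ (x ∷ xs ++ u′) ++ z ∷ ys
    w≡′ = trans w≡ (trans (cong ((x ∷ xs) ++_) (++-assoc u′ [ z ] ys))
                          (sym (++-assoc (x ∷ xs) u′ (z ∷ ys))))
    |u′| : length u′ ≡ suc n
    |u′| = suc-injective (trans (+-comm 1 (length u′)) (trans (sym (length-++ u′)) |u|))
    |u₀|≤ : length (u₀ k) ≤ length (x ∷ xs ++ u′)
    |u₀|≤ = subst (_≤ length (x ∷ xs ++ u′)) (sym (length-u₀ k))
              (s≤s (subst (_≤ length (xs ++ u′)) |u′| (length-++-≤ʳ u′ {xs})))

lemma1 : (k : ℕ) → 4 ≤ k → 4 ∣ k →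
         (w : List (Fin k)) (t : List (Fin 3)) → HasEncoding k w t → In31-2* t →
         (u : List (Fin k)) → length u ≡ k ∸ 1 → Unique u → Factor u w →
         ¬ Factor (reverse u) w
lemma1 _ 4≤0 (divides zero refl) = contradiction 4≤0 λ ()
lemma1 _ _ (divides (suc q) refl) _ _ enc ok u |u| u! u-factor ur-factor =
  reverse-has-no-completion u u! |u| (oddChoose2-3+*4 q)
    (factor-completion enc ok u u! |u| u-factor)
    (factor-completion enc ok (reverse u) (Unique-reverse u!) (trans (length-reverse u) |u|) ur-factor)
  where open Rankings (1 + q * 4) (cong not (odd-*4 q))
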